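{- Consider a Bounded Knapsack Problem instance with items $I=\{1,\dots,n\}$ (profits $p_i$, weights $w_i$, availabilities $d_i$, all positive integers), capacity $W$, items indexed in non-increasing order of efficiency $p_i/w_i$, break item $b$, left items $I_{\text{left}}=\{i:i<b\}$, incumbent value $z\in\mathbb{Z}$, and unfixed availability vector $u$ (as in the context). Let $I^1_{\text{left}}=\{i\in I_{\text{left}}: u_i=1\}$. Assume that every improved solution $x$ contains at least $|I^1_{\text{left}}|-1$ unfixed copies of items in $I^1_{\text{left}}$, i.e. $x_i=d_i$ holds for at least $|I^1_{\text{left}}|-1$ items $i\in I^1_{\text{left}}$. Let $h\in I^1_{\text{left}}$ and let $V_h$ be the optimal value of the FBKP relaxation of the modified instance obtained by reducing the availability of $h$ by one (defined precisely in the context). If $V_h<z+1$ (or the relaxation is infeasible), then one can set $u_h=0$ in the original instance without loss of optimality; that is, every improved solution $x$ satisfies $x_h=d_h$.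
   Context: A solution is an integer vector $x$ with $0\le x_i\le d_i$ and $\sum_iw_ix_i\le W$; its value is $\sum_ip_ix_i$. The break item $b$ satisfies $\sum_{i<b}d_iw_i\le W<\sum_{i\le b}d_iw_i$; items $i<b$ are left items, items $i\ge b$ right items. An improved solution is a solution with value at least $z+1$. The vector $u\in\mathbb{Z}^n$, $0\le u_i\le d_i$, is assumed to satisfy: every improved solution has $d_i-u_i\le x_i\le d_i$ for left $i$ and $0\le x_i\le u_i$ for right $i$. The modified instance for $h$ is described by fixed amounts $f_i$ and residual availabilities $r_i$: for left $i\notin I^1_{\text{left}}$, $f_i=d_i-u_i$, $r_i=u_i$; for $i\in I^1_{\text{left}}\setminus\{h\}$, $f_i=d_i$, $r_i=0$; $f_h=d_h-1$, $r_h=0$; for right $i$, $f_i=0$, $r_i=u_i$. Let $\widehat w_h=\sum_i f_iw_i$, let $I^h_{\text{res}}=\{i: r_i>0\}$ (assumed nonempty), let $g_h$ be the gcd of $\{w_i:i\in I^h_{\text{res}}\}$, and let $\overline W_h=\widehat w_h+\lfloor (W-\widehat w_h)/g_h\rfloor g_h$ (the divisibility-tightened capacity). The FBKP relaxation of the modified instance is the linear program: maximize $\sum_ip_ix_i$ over real $x$ with $f_i\le x_i\le f_i+r_i$ for all $i$ and $\sum_iw_ix_i\le \overline W_h$; $V_h$ is its optimal value. -}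

module Defs where

open import Data.Nat as ℕ using (ℕ; zero; suc; _≤_; _<_; _∸_)
open import Data.Nat.GCD using (gcd)
open import Data.Fin using (Fin; toℕ)
import Data.Fin as F
open import Data.Product using (Σ; _×_)
open import Relation.Nullary using (yes; no)
open import Data.Bool using (true; false; _∧_)
open import Data.Integer as ℤ using (ℤ; +_)
open import Data.Integer.DivMod using (_/ℕ_)
open import Data.Rational as ℚ using (ℚ)
open import Data.Bool using (Bool; if_then_else_)
open import Relation.Nullary using (does)
open import Relation.Binary.PropositionalEquality using (_≡_)

-- Items are indexed by Fin n (item i of the paper is index i-1).

∑ : ∀ {n} → (Fin n → ℕ) → ℕ
∑ {zero}  f = 0
∑ {suc n} f = f F.zero ℕ.+ ∑ (λ i → f (F.suc i))

∑ℚ : ∀ {n} → (Fin n → ℚ) → ℚ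
∑ℚ {zero}  f = ℚ.0ℚ
∑ℚ {suc n} f = f F.zero ℚ.+ ∑ℚ (λ i → f (F.suc i))

-- gcd of all values (gcd with 0 is neutral).
gcdAll : ∀ {n} → (Fin n → ℕ) → ℕ
gcdAll {zero}  f = 0
gcdAll {suc n} f = gcd (f F.zero) (gcdAll (λ i → f (F.suc i)))

ℕtoℚ : ℕ → ℚ
ℕtoℚ m = (+ m) ℚ./ 1

record BKP (n : ℕ) : Set where
  field
    p w d : Fin n → ℕ
    W     : ℕ

module _ {n : ℕ} (I : BKP n) where
  open BKP I

  weight : (Fin n → ℕ) → ℕ
  weight x = ∑ (λ i → w i ℕ.* x i)

  value : (Fin n → ℕ) → ℕ
  value x = ∑ (λ i → p i ℕ.* x i)

  IsSolution : (Fin n → ℕ) → Set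
  IsSolution x = (∀ i → x i ≤ d i) × (weight x ≤ W)

  IsImproved : ℤ → (Fin n → ℕ) → Set
  IsImproved z x = IsSolution x × (z ℤ.+ ℤ.1ℤ ℤ.≤ + value x)

  SortedByEfficiency : Set
  SortedByEfficiency = ∀ i j → toℕ i < toℕ j → p j ℕ.* w i ≤ p i ℕ.* w j

  IsBreakItem : Fin n → Set
  IsBreakItem b =
    (∑ (λ i → if does (toℕ i ℕ.<? toℕ b) then d i ℕ.* w i else 0) ≤ W) ×
    (W < ∑ (λ i → if does (toℕ i ℕ.≤? toℕ b) then d i ℕ.* w i else 0))

  Left : Fin n → Fin n → Set
  Left b i = toℕ i < toℕ b

  IsUnfixedVector : Fin n → ℤ → (Fin n → ℕ) → Set
  IsUnfixedVector b z u =
    (∀ i → u i ≤ d i) ×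
    (∀ x → IsImproved z x →
       (∀ i → toℕ i < toℕ b → (d i ∸ u i ≤ x i) × (x i ≤ d i)) ×
       (∀ i → toℕ b ≤ toℕ i → x i ≤ u i))

  inI1 : Fin n → (Fin n → ℕ) → Fin n → Bool
  inI1 b u i = does (toℕ i ℕ.<? toℕ b) ∧ does (u i ℕ.≟ 1)

  cardI1 : Fin n → (Fin n → ℕ) → ℕ
  cardI1 b u = ∑ (λ i → if inI1 b u i then 1 else 0)

  fullI1 : Fin n → (Fin n → ℕ) → (Fin n → ℕ) → ℕ
  fullI1 b u x = ∑ (λ i → if inI1 b u i ∧ does (x i ℕ.≟ d i) then 1 else 0)

  -- Modified instance for h: fixed amounts f_i and residual availabilities r_i
  fixd : Fin n → (Fin n → ℕ) → Fin n → Fin n → ℕ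
  fixd b u h i with toℕ i ℕ.<? toℕ b | inI1 b u i | toℕ i ℕ.≟ toℕ h
  ... | no _  | _     | _     = 0            -- right item
  ... | yes _ | _     | yes _ = d i ∸ 1      -- i = h
  ... | yes _ | true  | no _  = d i          -- i ∈ I¹_left ∖ {h}
  ... | yes _ | false | no _  = d i ∸ u i    -- other left items

  resid : Fin n → (Fin n → ℕ) → Fin n → Fin n → ℕ
  resid b u h i with toℕ i ℕ.<? toℕ b | inI1 b u i | toℕ i ℕ.≟ toℕ h
  ... | no _  | _     | _     = u i
  ... | yes _ | _     | yes _ = 0
  ... | yes _ | true  | no _  = 0
  ... | yes _ | false | no _  = u i

  wHat : Fin n → (Fin n → ℕ) → Fin n → ℕ
  wHat b u h = ∑ (λ i → fixd b u h i ℕ.* w i)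

  gRes : Fin n → (Fin n → ℕ) → Fin n → ℕ
  gRes b u h = gcdAll (λ i → if does (0 ℕ.<? resid b u h i) then w i else 0)

  ResNonempty : Fin n → (Fin n → ℕ) → Fin n → Set
  ResNonempty b u h = Σ (Fin n) (λ i → 0 < resid b u h i)

  -- W̄_h = ŵ_h + ⌊(W − ŵ_h)/g_h⌋ g_h   (floor division in ℤ; g_h > 0 whenever
  -- I^h_res is nonempty since weights are positive; the g_h = 0 branch is never used)
  tighten : ℕ → ℕ → ℤ
  tighten wh zero    = + W
  tighten wh (suc k) = + wh ℤ.+ ((+ W ℤ.- + wh) /ℕ suc k) ℤ.* + suc k

  WBar : Fin n → (Fin n → ℕ) → Fin n → ℤ
  WBar b u h = tighten (wHat b u h) (gRes b u h)

  -- x (real, here rational) is feasible for the FBKP relaxation of the modified instance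
  FBKPFeasible : Fin n → (Fin n → ℕ) → Fin n → (Fin n → ℚ) → Set
  FBKPFeasible b u h x =
    (∀ i → (ℕtoℚ (fixd b u h i) ℚ.≤ x i) ×
           (x i ℚ.≤ ℕtoℚ (fixd b u h i ℕ.+ resid b u h i))) ×
    (∑ℚ (λ i → ℕtoℚ (w i) ℚ.* x i) ℚ.≤ (WBar b u h ℚ./ 1))

  -- "V_h < z+1 or the relaxation is infeasible": every feasible point has
  -- objective value < z + 1.
  FBKPBelow : Fin n → (Fin n → ℕ) → Fin n → ℤ → Set
  FBKPBelow b u h z =
    ∀ x → FBKPFeasible b u h x →
      ∑ℚ (λ i → ℕtoℚ (p i) ℚ.* x i) ℚ.< ((z ℤ.+ ℤ.1ℤ) ℚ./ 1)

-- Suppose an improved solution x had x_h ≠ d_h. Since u_h = 1 this means x_h = d_h − 1, and the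
-- counting hypothesis then forces x_i = d_i on the rest of I¹_left, so x lies in the box
-- f ≤ x ≤ f + r of the modified instance. Coordinates with r_i = 0 equal f_i, hence the weight
-- of x is ŵ_h plus a multiple of g_h; being at most W, it is at most W̄_h. So x is a feasible
-- point of the FBKP relaxation, whose value is below z + 1: x is not improved.
module Submission where

open import Defs
open import Data.Nat using (ℕ; _≤_; _<_; _∸_)
open import Data.Integer using (ℤ)
open import Data.Fin using (Fin; toℕ)
open import Relation.Binary.PropositionalEquality using (_≡_)

open import Data.Nat using (zero; suc; _+_; _*_; _/_; NonZero; z≤n; _≟_; _<?_)
open import Data.Nat.Properties
open import Data.Nat.Divisibility using (_∣_; divides; ∣-trans; _∣0; ∣m∣n⇒∣m+n; m∣m*n)
open import Data.Nat.DivMod using (m*n/n≡m; /-monoˡ-≤)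
open import Data.Nat.GCD using (gcd[m,n]∣m; gcd[m,n]∣n)
open import Data.Nat.Coprimality using (1-coprimeTo) renaming (sym to coprime-sym)
open import Algebra.Properties.CommutativeSemigroup +-commutativeSemigroup using (interchange)
import Data.Integer as ℤ
import Data.Integer.Properties as ℤ
open import Data.Integer using (+_; -[1+_]; +≤+)
import Data.Rational as ℚ
open import Data.Rational using (mkℚ)
import Data.Rational.Properties as ℚ
import Data.Fin as Fin
open import Data.Fin.Properties using (toℕ-injective)
open import Data.Fin using (zero; suc)
open import Data.Bool using (true; false; _∧_; if_then_else_)
open import Data.Product using (_×_; _,_; proj₁; proj₂)
open import Function using (_∘_)
open import Relation.Nullary using (yes; no; does)
open import Relation.Nullary.Negation using (contradiction)
open import Relation.Nullary.Decidable using (dec-true; dec-false; decidable-stable)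
open import Relation.Binary.PropositionalEquality
  using (refl; sym; trans; cong; cong₂; subst; subst₂; _≢_; module ≡-Reasoning)

∑-cong : ∀ {n} {f g : Fin n → ℕ} → (∀ i → f i ≡ g i) → ∑ f ≡ ∑ g
∑-cong {zero}  f≗g = refl
∑-cong {suc n} f≗g = cong₂ _+_ (f≗g zero) (∑-cong (f≗g ∘ suc))

∑-distrib-+ : ∀ {n} (f g : Fin n → ℕ) → ∑ (λ i → f i + g i) ≡ ∑ f + ∑ g
∑-distrib-+ {zero}  f g = refl
∑-distrib-+ {suc n} f g = begin
  f zero + g zero + ∑ (λ i → f (suc i) + g (suc i))
    ≡⟨ cong (λ t → f zero + g zero + t) (∑-distrib-+ (f ∘ suc) (g ∘ suc)) ⟩
  f zero + g zero + (∑ (f ∘ suc) + ∑ (g ∘ suc))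
    ≡⟨ interchange (f zero) (g zero) (∑ (f ∘ suc)) (∑ (g ∘ suc)) ⟩
  ∑ f + ∑ g ∎
  where open ≡-Reasoning

∑-∸ : ∀ {n} {f g : Fin n → ℕ} → (∀ i → f i ≤ g i) → ∑ f + ∑ (λ i → g i ∸ f i) ≡ ∑ g
∑-∸ {f = f} f≤g = trans (sym (∑-distrib-+ f _)) (∑-cong (λ i → m+[n∸m]≡n (f≤g i)))

term≤∑ : ∀ {n} (f : Fin n → ℕ) k → f k ≤ ∑ f
term≤∑ f zero    = m≤m+n _ _
term≤∑ f (suc k) = ≤-trans (term≤∑ (f ∘ suc) k) (m≤n+m _ _)

two-terms≤∑ : ∀ {n} (f : Fin n → ℕ) {j k} → j ≢ k → f j + f k ≤ ∑ f
two-terms≤∑ f {zero}  {zero}  j≢k = contradiction refl j≢k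
two-terms≤∑ f {zero}  {suc k} _   = +-monoʳ-≤ (f zero) (term≤∑ (f ∘ suc) k)
two-terms≤∑ f {suc j} {zero}  _   =
  subst (_≤ ∑ f) (+-comm (f zero) (f (suc j))) (+-monoʳ-≤ (f zero) (term≤∑ (f ∘ suc) j))
two-terms≤∑ f {suc j} {suc k} j≢k =
  ≤-trans (two-terms≤∑ (f ∘ suc) (j≢k ∘ cong suc)) (m≤n+m _ _)

deficit-unique : ∀ {n} {f g : Fin n → ℕ} → (∀ i → f i ≤ g i) → ∑ g ∸ 1 ≤ ∑ f →
                 ∀ {j k} → f j < g j → f k < g k → j ≡ k
deficit-unique {n} {f} {g} f≤g slack {j} {k} fj<gj fk<gk with j Fin.≟ k
... | yes j≡k = j≡k
... | no  j≢k = contradiction (begin-strict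
  1 + ∑ f                 <⟨ n<1+n _ ⟩
  2 + ∑ f                 ≡⟨ +-comm 2 (∑ f) ⟩
  ∑ f + 2                 ≤⟨ +-monoʳ-≤ (∑ f) (+-mono-≤ (m<n⇒0<n∸m fj<gj) (m<n⇒0<n∸m fk<gk)) ⟩
  ∑ f + (δ j + δ k)       ≤⟨ +-monoʳ-≤ (∑ f) (two-terms≤∑ δ j≢k) ⟩
  ∑ f + ∑ δ               ≡⟨ ∑-∸ f≤g ⟩
  ∑ g                     ≤⟨ m≤n+m∸n (∑ g) 1 ⟩
  1 + (∑ g ∸ 1)           ≤⟨ +-monoʳ-≤ 1 slack ⟩
  1 + ∑ f                 ∎) (<-irrefl refl)
  where
  open ≤-Reasoning
  δ : Fin n → ℕ
  δ i = g i ∸ f i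

∑-∣ : ∀ {n} {m} {f : Fin n → ℕ} → (∀ i → m ∣ f i) → m ∣ ∑ f
∑-∣ {zero}  m∣f = _ ∣0
∑-∣ {suc n} m∣f = ∣m∣n⇒∣m+n (m∣f zero) (∑-∣ (m∣f ∘ suc))

gcdAll-∣ : ∀ {n} (f : Fin n → ℕ) i → gcdAll f ∣ f i
gcdAll-∣ f zero    = gcd[m,n]∣m _ _
gcdAll-∣ f (suc i) = ∣-trans (gcd[m,n]∣n (f zero) _) (gcdAll-∣ (f ∘ suc) i)

m∣n∧n≤o⇒n≤o/m*m : ∀ {m n o} .{{_ : NonZero m}} → m ∣ n → n ≤ o → n ≤ o / m * m
m∣n∧n≤o⇒n≤o/m*m {m} {o = o} (divides q refl) q*m≤o =
  *-monoˡ-≤ m (subst (_≤ o / m) (m*n/n≡m q m) (/-monoˡ-≤ m q*m≤o))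

m<n∧n∸1≤m⇒m≡n∸1 : ∀ {m n} → m < n → n ∸ 1 ≤ m → m ≡ n ∸ 1
m<n∧n∸1≤m⇒m≡n∸1 {n = suc n} m<n n≤m = ≤-antisym (≤-pred m<n) n≤m

/1≡mkℚ : ∀ i → i ℚ./ 1 ≡ mkℚ i 0 (coprime-sym (1-coprimeTo ℤ.∣ i ∣))
/1≡mkℚ (+ m)    = ℚ.normalize-coprime {m} {0} (coprime-sym (1-coprimeTo m))
/1≡mkℚ -[1+ m ] = cong ℚ.-_ (ℚ.normalize-coprime {suc m} {0} (coprime-sym (1-coprimeTo (suc m))))

/1-mono-≤ : ∀ {i j} → i ℤ.≤ j → i ℚ./ 1 ℚ.≤ j ℚ./ 1
/1-mono-≤ {i} {j} i≤j = subst₂ ℚ._≤_ (sym (/1≡mkℚ i)) (sym (/1≡mkℚ j))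
  (ℚ.*≤* (subst₂ ℤ._≤_ (sym (ℤ.*-identityʳ i)) (sym (ℤ.*-identityʳ j)) i≤j))

/1-cancel-< : ∀ {i j} → i ℚ./ 1 ℚ.< j ℚ./ 1 → i ℤ.< j
/1-cancel-< {i} {j} i<j = subst₂ ℤ._<_ (ℤ.*-identityʳ i) (ℤ.*-identityʳ j)
  (ℚ.drop-*<* (subst₂ ℚ._<_ (/1≡mkℚ i) (/1≡mkℚ j) i<j))

ℕtoℚ-mono-≤ : ∀ {m k} → m ≤ k → ℕtoℚ m ℚ.≤ ℕtoℚ k
ℕtoℚ-mono-≤ = /1-mono-≤ ∘ +≤+

ℕtoℚ-homo-+ : ∀ m k → ℕtoℚ (m + k) ≡ ℕtoℚ m ℚ.+ ℕtoℚ k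
ℕtoℚ-homo-+ m k rewrite /1≡mkℚ (+ m) | /1≡mkℚ (+ k) =
  cong (ℚ._/ 1) (trans (ℤ.pos-+ m k) (sym (cong₂ ℤ._+_ (ℤ.*-identityʳ (+ m)) (ℤ.*-identityʳ (+ k)))))

ℕtoℚ-homo-* : ∀ m k → ℕtoℚ (m * k) ≡ ℕtoℚ m ℚ.* ℕtoℚ k
ℕtoℚ-homo-* m k rewrite /1≡mkℚ (+ m) | /1≡mkℚ (+ k) = cong (ℚ._/ 1) (ℤ.pos-* m k)

∑ℚ-ℕtoℚ : ∀ {n} (a c : Fin n → ℕ) →
          ∑ℚ (λ i → ℕtoℚ (a i) ℚ.* ℕtoℚ (c i)) ≡ ℕtoℚ (∑ (λ i → a i * c i))
∑ℚ-ℕtoℚ {zero}  a c = refl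
∑ℚ-ℕtoℚ {suc n} a c = begin
  ℕtoℚ (a zero) ℚ.* ℕtoℚ (c zero) ℚ.+ ∑ℚ (λ i → ℕtoℚ (a (suc i)) ℚ.* ℕtoℚ (c (suc i)))
    ≡⟨ cong₂ ℚ._+_ (sym (ℕtoℚ-homo-* (a zero) (c zero))) (∑ℚ-ℕtoℚ (a ∘ suc) (c ∘ suc)) ⟩
  ℕtoℚ (a zero * c zero) ℚ.+ ℕtoℚ (∑ (λ i → a (suc i) * c (suc i)))
    ≡⟨ ℕtoℚ-homo-+ (a zero * c zero) _ ⟨
  ℕtoℚ (∑ (λ i → a i * c i)) ∎
  where open ≡-Reasoning

if∧≤if : ∀ a c → (if a ∧ c then 1 else 0) ≤ (if a then 1 else 0)
if∧≤if true  true  = ≤-refl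
if∧≤if true  false = z≤n
if∧≤if false _     = z≤n

if∧<if : ∀ {a c} → a ≡ true → c ≡ false → (if a ∧ c then 1 else 0) < (if a then 1 else 0)
if∧<if refl refl = ≤-refl

-- The junk branch g = 0 of tighten returns W, so the bound holds for every g.
tighten-≥ : ∀ {n} (I : BKP n) {wh s} g → g ∣ s → wh + s ≤ BKP.W I → + (wh + s) ℤ.≤ tighten I wh g
tighten-≥ I zero    _   wh+s≤W = +≤+ wh+s≤W
tighten-≥ I {wh} {s} g@(suc _) g∣s wh+s≤W = begin
  + (wh + s)                             ≤⟨ +≤+ (+-monoʳ-≤ wh (m∣n∧n≤o⇒n≤o/m*m g∣s s≤W∸wh)) ⟩
  + (wh + (W ∸ wh) / g * g)              ≡⟨ ℤ.pos-+ wh _ ⟩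
  + wh ℤ.+ + ((W ∸ wh) / g * g)          ≡⟨ cong (ℤ._+_ (+ wh)) (ℤ.pos-* ((W ∸ wh) / g) g) ⟩
  + wh ℤ.+ (+ (W ∸ wh) ℤ./ℕ g) ℤ.* + g   ≡⟨ cong (λ t → + wh ℤ.+ (t ℤ./ℕ g) ℤ.* + g) W-wh≡W∸wh ⟨
  tighten I wh g                         ∎
  where
  open ℤ.≤-Reasoning
  open BKP I using (W)
  s≤W∸wh : s ≤ W ∸ wh
  s≤W∸wh = m+n≤o⇒m≤o∸n s (subst (_≤ W) (+-comm wh s) wh+s≤W)
  W-wh≡W∸wh : + W ℤ.- + wh ≡ + (W ∸ wh)
  W-wh≡W∸wh = trans (ℤ.m-n≡m⊖n W wh) (ℤ.⊖-≥ (m+n≤o⇒m≤o wh wh+s≤W))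

module _ {n} (I : BKP n) (b : Fin n) (u : Fin n → ℕ) where
  open BKP I

  inI1-intro : ∀ {i} → toℕ i < toℕ b → u i ≡ 1 → inI1 I b u i ≡ true
  inI1-intro {i} i<b ui≡1 = cong₂ _∧_ (dec-true (toℕ i <? toℕ b) i<b) (dec-true (u i ≟ 1) ui≡1)

  module _ (x : Fin n → ℕ) where
    private
      member full : Fin n → ℕ
      member i = if inI1 I b u i then 1 else 0
      full   i = if inI1 I b u i ∧ does (x i ≟ d i) then 1 else 0

      full≤member : ∀ i → full i ≤ member i
      full≤member i = if∧≤if (inI1 I b u i) (does (x i ≟ d i))

      unfull : ∀ {i} → inI1 I b u i ≡ true → x i ≢ d i → full i < member i
      unfull {i} i∈I1 xi≢di = if∧<if i∈I1 (dec-false (x i ≟ d i) xi≢di)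

    others-full : cardI1 I b u ∸ 1 ≤ fullI1 I b u x →
                  ∀ {h} → inI1 I b u h ≡ true → x h ≢ d h →
                  ∀ {j} → inI1 I b u j ≡ true → j ≢ h → x j ≡ d j
    others-full slack h∈I1 xh≢dh {j} j∈I1 j≢h = decidable-stable (x j ≟ d j) λ xj≢dj →
      j≢h (deficit-unique full≤member slack (unfull j∈I1 xj≢dj) (unfull h∈I1 xh≢dh))

  module _ (h : Fin n) where
    private
      f r : Fin n → ℕ
      f = fixd I b u h
      r = resid I b u h

    InModifiedBox : (Fin n → ℕ) → Set
    InModifiedBox x = ∀ i → f i ≤ x i × x i ≤ f i + r i

    bounds⇒InModifiedBox : ∀ {x} → (∀ i → u i ≤ d i) →
      (∀ i → toℕ i < toℕ b → d i ∸ u i ≤ x i × x i ≤ d i) →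
      (∀ i → toℕ b ≤ toℕ i → x i ≤ u i) →
      x h ≡ d h ∸ 1 → (∀ {j} → inI1 I b u j ≡ true → j ≢ h → x j ≡ d j) →
      InModifiedBox x
    bounds⇒InModifiedBox {x} u≤d left right xh≡dh∸1 full i
      with toℕ i <? toℕ b | inI1 I b u i in i∈I1? | toℕ i ≟ toℕ h
    ... | no i≮b | _ | _ = z≤n , right i (≮⇒≥ i≮b)
    ... | yes _ | _ | yes i≡h with toℕ-injective i≡h
    ...   | refl = ≤-reflexive (sym xh≡dh∸1) , ≤-reflexive (trans xh≡dh∸1 (sym (+-identityʳ _)))
    bounds⇒InModifiedBox {x} u≤d left right xh≡dh∸1 full i | yes _ | true | no i≢h =
      ≤-reflexive (sym xi≡di) , ≤-reflexive (trans xi≡di (sym (+-identityʳ _)))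
      where
      xi≡di : x i ≡ d i
      xi≡di = full i∈I1? (i≢h ∘ cong toℕ)
    bounds⇒InModifiedBox {x} u≤d left right xh≡dh∸1 full i | yes i<b | false | no _ =
      proj₁ (left i i<b) , subst (x i ≤_) (sym (m∸n+n≡m (u≤d i))) (proj₂ (left i i<b))

    module _ {x : Fin n → ℕ} (inBox : InModifiedBox x) where
      weight-split : weight I x ≡ wHat I b u h + ∑ (λ i → w i * (x i ∸ f i))
      weight-split = trans (∑-cong split) (∑-distrib-+ (λ i → f i * w i) _)
        where
        split : ∀ i → w i * x i ≡ f i * w i + w i * (x i ∸ f i)
        split i = begin
          w i * x i                           ≡⟨ cong (w i *_) (m+[n∸m]≡n (proj₁ (inBox i))) ⟨
          w i * (f i + (x i ∸ f i))           ≡⟨ *-distribˡ-+ (w i) (f i) _ ⟩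
          w i * f i + w i * (x i ∸ f i)       ≡⟨ cong (_+ w i * (x i ∸ f i)) (*-comm (w i) (f i)) ⟩
          f i * w i + w i * (x i ∸ f i)       ∎
          where open ≡-Reasoning

      gRes-∣-shift : ∀ i → gRes I b u h ∣ w i * (x i ∸ f i)
      gRes-∣-shift i = by-resid (r i) (gcdAll-∣ _ i) (proj₂ (inBox i))
        where
        by-resid : ∀ ri → gRes I b u h ∣ (if does (0 <? ri) then w i else 0) →
                   x i ≤ f i + ri → gRes I b u h ∣ w i * (x i ∸ f i)
        by-resid (suc _) g∣wi _ = ∣-trans g∣wi (m∣m*n _)
        by-resid zero    _ xi≤fi+0 = subst (gRes I b u h ∣_) (sym shift≡0) (_ ∣0)
          where
          shift≡0 : w i * (x i ∸ f i) ≡ 0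
          shift≡0 = trans (cong (w i *_) (m≤n⇒m∸n≡0 (subst (x i ≤_) (+-identityʳ (f i)) xi≤fi+0)))
                      (*-zeroʳ (w i))

      weight≤WBar : weight I x ≤ W → + weight I x ℤ.≤ WBar I b u h
      weight≤WBar weight≤W = subst (λ t → + t ℤ.≤ WBar I b u h) (sym weight-split)
        (tighten-≥ I (gRes I b u h) (∑-∣ gRes-∣-shift) (subst (_≤ W) weight-split weight≤W))

      FBKPFeasible-ℕtoℚ : weight I x ≤ W → FBKPFeasible I b u h (ℕtoℚ ∘ x)
      FBKPFeasible-ℕtoℚ weight≤W =
        (λ i → ℕtoℚ-mono-≤ (proj₁ (inBox i)) , ℕtoℚ-mono-≤ (proj₂ (inBox i))) ,
        subst (ℚ._≤ WBar I b u h ℚ./ 1) (sym (∑ℚ-ℕtoℚ w x)) (/1-mono-≤ (weight≤WBar weight≤W))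

    FBKPBelow⇒value< : ∀ {z x} → FBKPBelow I b u h z → FBKPFeasible I b u h (ℕtoℚ ∘ x) →
                       + value I x ℤ.< z ℤ.+ ℤ.1ℤ
    FBKPBelow⇒value< {z} {x} below feasible =
      /1-cancel-< (subst (ℚ._< (z ℤ.+ ℤ.1ℤ) ℚ./ 1) (∑ℚ-ℕtoℚ p x) (below _ feasible))

theorem1 : (n : ℕ) (I : BKP n) →
    (∀ i → 0 < BKP.p I i) → (∀ i → 0 < BKP.w I i) → (∀ i → 0 < BKP.d I i) →
    SortedByEfficiency I →
    (b : Fin n) → IsBreakItem I b →
    (z : ℤ) (u : Fin n → ℕ) → IsUnfixedVector I b z u →
    (∀ x → IsImproved I z x → cardI1 I b u ∸ 1 ≤ fullI1 I b u x) →
    (h : Fin n) → toℕ h < toℕ b → u h ≡ 1 →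
    ResNonempty I b u h →
    FBKPBelow I b u h z →
    ∀ x → IsImproved I z x → x h ≡ BKP.d I h
theorem1 n I _ _ _ _ b _ z u (u≤d , unfixed) slack h h<b uh≡1 _ below x
         improved@((_ , weight≤W) , z+1≤value) =
  decidable-stable (x h ≟ d h) λ xh≢dh → ℤ.<⇒≱ (value<z+1 xh≢dh) z+1≤value
  where
  open BKP I using (d)

  left : ∀ i → toℕ i < toℕ b → d i ∸ u i ≤ x i × x i ≤ d i
  left = proj₁ (unfixed x improved)

  xh≡dh∸1 : x h ≢ d h → x h ≡ d h ∸ 1
  xh≡dh∸1 xh≢dh = m<n∧n∸1≤m⇒m≡n∸1 (≤∧≢⇒< (proj₂ (left h h<b)) xh≢dh)
                    (subst (λ t → d h ∸ t ≤ x h) uh≡1 (proj₁ (left h h<b)))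

  inBox : x h ≢ d h → InModifiedBox I b u h x
  inBox xh≢dh = bounds⇒InModifiedBox I b u h u≤d left (proj₂ (unfixed x improved)) (xh≡dh∸1 xh≢dh)
    (others-full I b u x (slack x improved) (inI1-intro I b u h<b uh≡1) xh≢dh)

  value<z+1 : x h ≢ d h → + value I x ℤ.< z ℤ.+ ℤ.1ℤ
  value<z+1 xh≢dh =
    FBKPBelow⇒value< I b u h {z} {x} below (FBKPFeasible-ℕtoℚ I b u h (inBox xh≢dh) weight≤W)
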